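{- For all $p<0$ and all $n\ge1$ there exists a bijection $$\hat\psi_p:\bigcup_{p\le p'\le 0}\mathcal{H}_{n,p'}\longrightarrow \mathcal{Q}_{n,p},$$ where $\mathcal{H}_{n,p'}$ is the set of H-trees of degree $n$ and base-length $p'$ and $\mathcal{Q}_{n,p}$ is the set of Q-trees of degree $n$ and base-length $p$.
   Context: A rooted binary plane tree $T$ has a root $v_0$ of degree 1; every other vertex is a leaf (degree 1) or internal (degree 3, with parent edge $v^-$ and ordered left/right child edges $v^{\mathrm L},v^{\mathrm R}$). $e_0$ is the edge at $v_0$. A partition tree of degree $n$ and base-length $p$ is $(T,v_0,f_V,f_E)$ with $T$ having $n$ leaves, $f_V:V_I(T)\to\mathbb{Z}_{\ge0}$ on internal vertices, $f_E:E(T)\to\mathbb{Z}$, $f_V(v)=f_E(v^{\mathrm L})+f_E(v^{\mathrm R})-f_E(v^-)+1$ for all internal $v$, and $f_E(e_0)=p$. An edge is positive if its label is $>0$. An internal $v$ is a bottom vertex if $\mathbf{1}_{f_E(v^-)\le0}<\mathbf{1}_{f_E(v^{\mathrm L})\le0}+\mathbf{1}_{f_E(v^{\mathrm R})\le0}$, otherwise a top vertex. An H-tree of degree $n\ge1$, base-length $p$ is a partition tree such that $f_E(e)=0$ iff $e$ is incident to a leaf, and $f_V(v)=0$ for every top vertex. A pre-Q-tree is a partition tree with $n\ge1$ such that $f_E(e)\le0$ for every edge incident to a leaf and $f_V\equiv0$. Paths: for each bottom vertex $v$, the regular path starts with the rightmost non-positive child edge of $v$ and then repeatedly continues with the leftmost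 non-positive child edge of the lower endpoint of the current edge, until a leaf; if $p\le0$, the root path starts with $e_0$ and continues by the same rule; for each bottom vertex $v$ with positive parent edge and two non-positive child edges, the special path starts with $v^{\mathrm L}$ and continues by the same rule. A path is strong if the edge labels along it attain a unique maximum at its last edge (the one incident to a leaf). A Q-tree is a pre-Q-tree all of whose paths are strong. -}

module Defs where

open import Data.Nat as ℕ using (ℕ; zero; suc)
open import Data.Integer as ℤ using (ℤ; +_; 0ℤ; 1ℤ; _≤ᵇ_)
open import Data.Bool using (Bool; true; false; if_then_else_; _∧_; not)
open import Data.List using (List; []; _∷_; _++_)
open import Data.List.Relation.Unary.All using (All)
open import Data.Unit using (⊤)
open import Data.Empty using (⊥)
open import Data.Product using (Σ; _×_)
open import Relation.Binary.PropositionalEquality using (_≡_)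
open import Function.Bundles using (_⤖_)

-- Every edge e is identified with the
-- subtree hanging below it (its lower endpoint is a leaf or an internal vertex).
--   leaf e        : an edge with label f_E = e whose lower endpoint is a leaf
--   node e v l r  : an edge with label f_E = e whose lower endpoint is an
--                   internal vertex with label f_V = v, left child edge l
--                   and right child edge r.
data LTree : Set where
  leaf : (e : ℤ) → LTree
  node : (e : ℤ) (v : ℕ) (l r : LTree) → LTree

edge : LTree → ℤ
edge (leaf e)       = e
edge (node e _ _ _) = e

leaves : LTree → ℕ
leaves (leaf _)       = 1
leaves (node _ _ l r) = leaves l ℕ.+ leaves r

LabelRule : LTree → Set
LabelRule (leaf _)       = ⊤
LabelRule (node e v l r) =
  (+ v ≡ edge l ℤ.+ edge r ℤ.- e ℤ.+ 1ℤ) × LabelRule l × LabelRule r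

IsPartitionTree : ℕ → ℤ → LTree → Set
IsPartitionTree n p t = (leaves t ≡ n) × (edge t ≡ p) × LabelRule t

nonpos : ℤ → Bool
nonpos x = x ≤ᵇ 0ℤ

ind : ℤ → ℕ
ind x = if nonpos x then 1 else 0

isBottom : ℤ → LTree → LTree → Bool
isBottom e l r = ind e ℕ.<ᵇ ind (edge l) ℕ.+ ind (edge r)

HCond : LTree → Set
HCond (leaf e)       = e ≡ 0ℤ
HCond (node e v l r) =
  ℤ.NonZero e × (if isBottom e l r then ⊤ else v ≡ 0) × HCond l × HCond r

IsHTree : ℕ → ℤ → LTree → Set
IsHTree n p t = IsPartitionTree n p t × HCond t

PreQCond : LTree → Set
PreQCond (leaf e)       = e ℤ.≤ 0ℤ
PreQCond (node e v l r) = (v ≡ 0) × PreQCond l × PreQCond r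

-- labels along the path starting with the given edge and continuing with the
-- leftmost non-positive child edge of the lower endpoint, until a leaf
-- (stops early if no non-positive child exists, which cannot happen in a pre-Q-tree)
pathFrom : LTree → List ℤ
pathFrom (leaf e)       = e ∷ []
pathFrom (node e v l r) =
  e ∷ (if nonpos (edge l) then pathFrom l
       else if nonpos (edge r) then pathFrom r else [])

-- regular paths (one per bottom vertex, starting with its rightmost
-- non-positive child edge) and special paths (for bottom vertices with
-- positive parent edge and two non-positive child edges, starting with v^L)
innerPaths : LTree → List (List ℤ)
innerPaths (leaf _)       = []
innerPaths (node e v l r) =
  (if isBottom e l r
   then (if nonpos (edge r) then pathFrom r else pathFrom l) ∷ []
   else [])
  ++ (if isBottom e l r ∧ not (nonpos e) ∧ nonpos (edge l) ∧ nonpos (edge r)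
      then pathFrom l ∷ []
      else [])
  ++ innerPaths l ++ innerPaths r

allPaths : LTree → List (List ℤ)
allPaths t = (if nonpos (edge t) then pathFrom t ∷ [] else []) ++ innerPaths t

lastOf : ℤ → List ℤ → ℤ
lastOf y []       = y
lastOf y (z ∷ zs) = lastOf z zs

-- strong: the labels attain a unique maximum at the last edge
Strong : List ℤ → Set
Strong []           = ⊥
Strong (x ∷ [])     = ⊤
Strong (x ∷ y ∷ xs) = (x ℤ.< lastOf y xs) × Strong (y ∷ xs)

IsQTree : ℕ → ℤ → LTree → Set
IsQTree n p t = IsPartitionTree n p t × PreQCond t × All Strong (allPaths t)

HTrees : ℕ → ℤ → Set
HTrees n p = Σ LTree (IsHTree n p)

QTrees : ℕ → ℤ → Set
QTrees n p = Σ LTree (IsQTree n p)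

HUnion : ℕ → ℤ → Set
HUnion n p = Σ ℤ (λ p' → (p ℤ.≤ p') × (p' ℤ.≤ 0ℤ) × HTrees n p')

-- Both maps keep the shape of the tree and its positive edge labels, and move the non-positive labels
-- by a constant along each path (the leftmost non-positive descent from an edge to a leaf).  In an
-- H-tree every path ends at a leaf labelled 0 and all its other labels are negative.  ψ lowers the
-- root path by p′ - p and each regular path by the label of the vertex it starts from (a special path
-- by 0).  This makes every vertex label 0, and every path strong: lowering by s sends the final label
-- to -s and all others below it.  ψ⁻¹ raises each non-positive edge by minus the label ending its
-- path; the resulting vertex labels, the net raise at each vertex, are non-negative and vanish at top
-- vertices, and the root label becomes p - d ∈ [p, 0], where d ≥ p is the label ending the root path.

module Submission where

open import Defs
open import Data.Nat using (ℕ)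
open import Data.Integer using (ℤ; 0ℤ; _<_)
open import Function.Bundles using (_⤖_)

open import Data.Nat as ℕ using (zero)
open import Data.Integer as ℤ using (+_; 1ℤ; _-_; -_; _≤_; ∣_∣; +[1+_]; -[1+_])
import Data.Integer.Properties as ℤP
open import Data.Integer.Tactic.RingSolver using (solve-∀)
open import Data.Bool using (Bool; true; false; if_then_else_; T)
open import Data.List using ([]; _∷_; _++_)
open import Data.List.Relation.Unary.All as All using (All; []; _∷_)
open import Data.List.Relation.Unary.All.Properties using (++⁻; ++⁺)
open import Data.Unit using (⊤; tt)
open import Data.Empty using (⊥-elim)
open import Data.Product using (_×_; _,_; proj₁; proj₂)
open import Relation.Binary.PropositionalEquality
  using (_≡_; _≢_; refl; sym; trans; cong; cong₂; subst; module ≡-Reasoning)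
open import Relation.Nullary.Irrelevant using (Irrelevant)
open import Axiom.UniquenessOfIdentityProofs.WithK using (uip)
open import Function.Bundles using (mk↔ₛ′)
open import Function.Properties.Inverse using (↔⇒⤖)

nonpos⇒≤0 : ∀ {x} → nonpos x ≡ true → x ≤ 0ℤ
nonpos⇒≤0 eq = ℤP.≤ᵇ⇒≤ (subst T (sym eq) tt)

¬nonpos⇒>0 : ∀ {x} → nonpos x ≡ false → 0ℤ < x
¬nonpos⇒>0 eq = ℤP.≰⇒> (λ x≤0 → subst T eq (ℤP.≤⇒≤ᵇ x≤0))

≤0⇒nonpos : ∀ {x} → x ≤ 0ℤ → nonpos x ≡ true
≤0⇒nonpos {x} x≤0 with nonpos x in eq
... | true  = refl
... | false = ⊥-elim (ℤP.<⇒≱ (¬nonpos⇒>0 eq) x≤0)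

true≢false : ∀ {A : Set} {b} → b ≡ true → b ≡ false → A
true≢false refl ()

nonpos∧nonZero⇒<0 : ∀ {e} → nonpos e ≡ true → ℤ.NonZero e → e < 0ℤ
nonpos∧nonZero⇒<0 {+ zero}    _  ()
nonpos∧nonZero⇒<0 {+[1+ n ]}  ()
nonpos∧nonZero⇒<0 { -[1+ n ]} _  _ = ℤ.-<+

i<j⇒i-j<0 : ∀ {i j} → i < j → i - j < 0ℤ
i<j⇒i-j<0 {i} {j} i<j = subst (i - j <_) (ℤP.+-inverseʳ j) (ℤP.+-monoˡ-< (- j) i<j)

i-j-[-j]≡i : ∀ i j → i - j - (- j) ≡ i
i-j-[-j]≡i = solve-∀

i-[i+j]≡-j : ∀ i j → i - (i ℤ.+ j) ≡ - j
i-[i+j]≡-j = solve-∀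

0-[i+0]≡-i : ∀ i → 0ℤ - (i ℤ.+ 0ℤ) ≡ - i
0-[i+0]≡-i = solve-∀

0-[0+j]≡-j : ∀ j → 0ℤ - (0ℤ ℤ.+ j) ≡ - j
0-[0+j]≡-j = solve-∀

i-[i-j]≡j : ∀ i j → i - (i - j) ≡ j
i-[i-j]≡j = solve-∀

i-j-i≡-j : ∀ i j → i - j - i ≡ - j
i-j-i≡-j = solve-∀

i-[-[j-i]]≡j : ∀ i j → i - (- (j - i)) ≡ j
i-[-[j-i]]≡j = solve-∀

offset : ℤ → ℤ → ℤ
offset d x = if nonpos x then d else 0ℤ

offset-cong : ∀ d x y → nonpos x ≡ nonpos y → offset d x ≡ offset d y
offset-cong d _ _ = cong (λ b → if b then d else 0ℤ)

offset-inverse : ∀ x d s → (nonpos x ≡ true → s ≡ - d) → offset s x ≡ - offset d x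
offset-inverse x d s s≡-d with nonpos x
... | true  = s≡-d refl
... | false = refl

nonpos-lower : ∀ x d → (nonpos x ≡ true → x ≤ d) → nonpos (x - offset d x) ≡ nonpos x
nonpos-lower x d x≤d with nonpos x in eq
... | true  = ≤0⇒nonpos (ℤP.i≤j⇒i-j≤0 (x≤d refl))
... | false = trans (cong nonpos (ℤP.+-identityʳ x)) eq

nonZero-lower : ∀ x d → (nonpos x ≡ true → x < d) → ℤ.NonZero (x - offset d x)
nonZero-lower x d x<d with nonpos x in eq
... | true  = ℤ.<-nonZero (i<j⇒i-j<0 (x<d refl))
... | false = ℤ.>-nonZero (subst (0ℤ <_) (sym (ℤP.+-identityʳ x)) (¬nonpos⇒>0 eq))

vertexLabel : ℤ → ℤ → ℤ → ℤ
vertexLabel e l r = l ℤ.+ r - e ℤ.+ 1ℤ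

vertexLabel-cong : ∀ {e e′ l l′ r r′} → e ≡ e′ → l ≡ l′ → r ≡ r′ →
                   vertexLabel e l r ≡ vertexLabel e′ l′ r′
vertexLabel-cong refl refl refl = refl

vertexLabel-lower : ∀ e l r c a b → vertexLabel (e - c) (l - a) (r - b) ≡ vertexLabel e l r ℤ.+ c - (a ℤ.+ b)
vertexLabel-lower = identity
  where
  identity : ∀ e l r c a b →
             (l - a) ℤ.+ (r - b) - (e - c) ℤ.+ 1ℤ ≡ (l ℤ.+ r - e ℤ.+ 1ℤ) ℤ.+ c - (a ℤ.+ b)
  identity = solve-∀

nonpos-pos-pos⇒vertex≢0 : ∀ e l r {v} → nonpos e ≡ true → nonpos l ≡ false → nonpos r ≡ false →
                           + v ≡ vertexLabel e l r → v ≢ 0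
nonpos-pos-pos⇒vertex≢0 e l r e≤0 0<l 0<r eq refl = ℤP.<-irrefl (trans eq (reassoc e l r)) 0<vertex
  where
  reassoc : ∀ e l r → l ℤ.+ r - e ℤ.+ 1ℤ ≡ l ℤ.+ (r ℤ.+ (- e ℤ.+ 1ℤ))
  reassoc = solve-∀
  0<vertex : 0ℤ < l ℤ.+ (r ℤ.+ (- e ℤ.+ 1ℤ))
  0<vertex = ℤP.+-mono-<-≤ (¬nonpos⇒>0 {l} 0<l)
               (ℤP.+-mono-≤ (ℤP.<⇒≤ (¬nonpos⇒>0 {r} 0<r))
                 (ℤP.+-mono-≤ (ℤP.neg-mono-≤ (nonpos⇒≤0 {e} e≤0)) (ℤ.+≤+ {0} {1} ℕ.z≤n)))

isBottom-cong : ∀ x l r y l′ r′ → nonpos x ≡ nonpos y → nonpos (edge l) ≡ nonpos (edge l′) →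
                nonpos (edge r) ≡ nonpos (edge r′) → isBottom x l r ≡ isBottom y l′ r′
isBottom-cong _ _ _ _ _ _ ex el er =
  cong₂ ℕ._<ᵇ_ (cong indicator ex) (cong₂ ℕ._+_ (cong indicator el) (cong indicator er))
  where
  indicator : Bool → ℕ
  indicator b = if b then 1 else 0

topCondition : ∀ b {n} → (b ≡ false → n ≡ 0) → if b then ⊤ else n ≡ 0
topCondition true  _   = tt
topCondition false n≡0 = n≡0 refl

node-cong : ∀ {e e′ v v′ l l′ r r′} → e ≡ e′ → v ≡ v′ → l ≡ l′ → r ≡ r′ →
            node e v l r ≡ node e′ v′ l′ r′
node-cong refl refl refl refl = refl

-- Descents and strong paths

descentEnd : LTree → ℤ
descentEnd (leaf e)       = e
descentEnd (node e _ l r) =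
  if nonpos (edge l) then descentEnd l else if nonpos (edge r) then descentEnd r else e

lastOf-pathFrom : ∀ x t → lastOf x (pathFrom t) ≡ descentEnd t
lastOf-pathFrom x (leaf e) = refl
lastOf-pathFrom x (node e v l r) with nonpos (edge l)
... | true = lastOf-pathFrom e l
... | false with nonpos (edge r)
...   | true  = lastOf-pathFrom e r
...   | false = refl

Strong-∷⁺ : ∀ e t → e < descentEnd t → Strong (pathFrom t) → Strong (e ∷ pathFrom t)
Strong-∷⁺ e (leaf y)         e<d s = e<d , s
Strong-∷⁺ e t@(node y _ _ _) e<d s = subst (e <_) (sym (lastOf-pathFrom e t)) e<d , s

Strong-∷⁻ : ∀ e t → Strong (e ∷ pathFrom t) → e < descentEnd t × Strong (pathFrom t)
Strong-∷⁻ e (leaf y)         (e<d , s) = e<d , s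
Strong-∷⁻ e t@(node y _ _ _) (e<d , s) = subst (e <_) (lastOf-pathFrom e t) e<d , s

StartsStrongPath : LTree → Set
StartsStrongPath t = nonpos (edge t) ≡ true → Strong (pathFrom t)

Everywhere : (LTree → Set) → LTree → Set
Everywhere P t@(leaf _)       = P t
Everywhere P t@(node _ _ l r) = P t × Everywhere P l × Everywhere P r

here : ∀ {P} t → Everywhere P t → P t
here (leaf _)       p       = p
here (node _ _ _ _) (p , _) = p

-- A non-positive child edge either continues the path of its parent edge, or starts a regular or
-- special path of its upper endpoint.
innerPaths-node⁻ : ∀ e v l r → All Strong (innerPaths (node e v l r)) → StartsStrongPath (node e v l r) →
                   StartsStrongPath l × StartsStrongPath r × All Strong (innerPaths l ++ innerPaths r)
innerPaths-node⁻ e v l r ps root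
  with nonpos e | nonpos (edge l) | nonpos (edge r) | ps
... | true  | true  | true  | pr ∷ ps′      = (λ _ → proj₂ (Strong-∷⁻ e l (root refl))) , (λ _ → pr) , ps′
... | true  | true  | false | ps′           = (λ _ → proj₂ (Strong-∷⁻ e l (root refl))) , (λ ()) , ps′
... | true  | false | true  | ps′           = (λ ()) , (λ _ → proj₂ (Strong-∷⁻ e r (root refl))) , ps′
... | true  | false | false | ps′           = (λ ()) , (λ ()) , ps′
... | false | true  | true  | pr ∷ pl ∷ ps′ = (λ _ → pl) , (λ _ → pr) , ps′
... | false | true  | false | pl ∷ ps′      = (λ _ → pl) , (λ ()) , ps′
... | false | false | true  | pr ∷ ps′      = (λ ()) , (λ _ → pr) , ps′
... | false | false | false | ps′           = (λ ()) , (λ ()) , ps′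

innerPaths⇒everywhere : ∀ t → All Strong (innerPaths t) → StartsStrongPath t → Everywhere StartsStrongPath t
innerPaths⇒everywhere (leaf _)       _  root = root
innerPaths⇒everywhere (node e v l r) ps root with innerPaths-node⁻ e v l r ps root
... | sl , sr , ps′ with ++⁻ (innerPaths l) ps′
...   | psl , psr = root , innerPaths⇒everywhere l psl sl , innerPaths⇒everywhere r psr sr

innerPaths-node⁺ : ∀ e v l r → StartsStrongPath l → StartsStrongPath r →
                   All Strong (innerPaths l ++ innerPaths r) → All Strong (innerPaths (node e v l r))
innerPaths-node⁺ e v l r sl sr ps with nonpos e | nonpos (edge l) | nonpos (edge r)
... | true  | true  | true  = sr refl ∷ ps
... | true  | true  | false = ps
... | true  | false | true  = ps
... | true  | false | false = ps
... | false | true  | true  = sr refl ∷ sl refl ∷ ps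
... | false | true  | false = sl refl ∷ ps
... | false | false | true  = sr refl ∷ ps
... | false | false | false = ps

everywhere⇒innerPaths : ∀ t → Everywhere StartsStrongPath t → All Strong (innerPaths t)
everywhere⇒innerPaths (leaf _)       _               = []
everywhere⇒innerPaths (node e v l r) (_ , evl , evr) =
  innerPaths-node⁺ e v l r (here l evl) (here r evr)
    (++⁺ (everywhere⇒innerPaths l evl) (everywhere⇒innerPaths r evr))

allPaths⇒everywhere : ∀ t → All Strong (allPaths t) → Everywhere StartsStrongPath t
allPaths⇒everywhere t ps with nonpos (edge t) in et | ps
... | true  | p ∷ ps′ = innerPaths⇒everywhere t ps′ (λ _ → p)
... | false | ps′     = innerPaths⇒everywhere t ps′ (λ np → true≢false np et)

everywhere⇒allPaths : ∀ t → Everywhere StartsStrongPath t → All Strong (allPaths t)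
everywhere⇒allPaths t ev with nonpos (edge t) in et
... | true  = here t ev et ∷ everywhere⇒innerPaths t ev
... | false = everywhere⇒innerPaths t ev

-- From H-trees to Q-trees

HTreeCond : LTree → Set
HTreeCond t = LabelRule t × HCond t

QTreeCond : LTree → Set
QTreeCond t = LabelRule t × PreQCond t × Everywhere StartsStrongPath t

HTreeCond-children : ∀ {e v l r} → HTreeCond (node e v l r) → HTreeCond l × HTreeCond r
HTreeCond-children ((_ , rl , rr) , (_ , _ , hl , hr)) = (rl , hl) , (rr , hr)

QTreeCond-children : ∀ {e v l r} → QTreeCond (node e v l r) → QTreeCond l × QTreeCond r
QTreeCond-children ((_ , rl , rr) , (_ , pl , pr) , (_ , evl , evr)) = (rl , pl , evl) , (rr , pr , evr)

-- The path continuing the parent edge keeps its shift s; a regular path starting at the vertex is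
-- lowered by the vertex label v (a special path by 0), which brings the new vertex label to 0.
leftShift : ℤ → ℕ → LTree → ℤ → ℤ
leftShift e v r s = if nonpos e then s else if nonpos (edge r) then 0ℤ else + v

rightShift : ℤ → ℕ → LTree → ℤ → ℤ
rightShift e v l s = if nonpos e then (if nonpos (edge l) then + v else s) else + v

toQ : ℤ → LTree → LTree
toQ s (leaf e)       = leaf (e - offset s e)
toQ s (node e v l r) = node (e - offset s e) 0 (toQ (leftShift e v r s) l) (toQ (rightShift e v l s) r)

edge-toQ : ∀ s t → edge (toQ s t) ≡ edge t - offset s (edge t)
edge-toQ s (leaf _)       = refl
edge-toQ s (node _ _ _ _) = refl

leaves-toQ : ∀ s t → leaves (toQ s t) ≡ leaves t
leaves-toQ s (leaf _)       = refl
leaves-toQ s (node e v l r) = cong₂ ℕ._+_ (leaves-toQ _ l) (leaves-toQ _ r)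

leftShift-nonneg : ∀ e v r {s} → 0ℤ ≤ s → 0ℤ ≤ leftShift e v r s
leftShift-nonneg e v r 0≤s with nonpos e | nonpos (edge r)
... | true  | _     = 0≤s
... | false | true  = ℤP.≤-refl
... | false | false = ℤ.+≤+ ℕ.z≤n

rightShift-nonneg : ∀ e v l {s} → 0ℤ ≤ s → 0ℤ ≤ rightShift e v l s
rightShift-nonneg e v l 0≤s with nonpos e | nonpos (edge l)
... | true  | true  = ℤ.+≤+ ℕ.z≤n
... | true  | false = 0≤s
... | false | _     = ℤ.+≤+ ℕ.z≤n

nonpos-toQ : ∀ s t → 0ℤ ≤ s → nonpos (edge (toQ s t)) ≡ nonpos (edge t)
nonpos-toQ s t 0≤s = trans (cong nonpos (edge-toQ s t))
  (nonpos-lower (edge t) s (λ np → ℤP.≤-trans (nonpos⇒≤0 np) 0≤s))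

descentEnd-toQ : ∀ s t → HTreeCond t → 0ℤ ≤ s → nonpos (edge t) ≡ true → descentEnd (toQ s t) ≡ - s
descentEnd-toQ s (leaf .0ℤ) (_ , refl) _ _ = ℤP.+-identityˡ (- s)
descentEnd-toQ s (node e v l r) ((veq , rl , rr) , (_ , top , hl , hr)) 0≤s np
  rewrite np with nonpos (edge l) in el | nonpos (edge r) in er
... | true  | _ rewrite trans (nonpos-toQ s l 0≤s) el = descentEnd-toQ s l (rl , hl) 0≤s el
... | false | true rewrite trans (nonpos-toQ s l 0≤s) el | trans (nonpos-toQ s r 0≤s) er =
  descentEnd-toQ s r (rr , hr) 0≤s er
... | false | false = ⊥-elim (nonpos-pos-pos⇒vertex≢0 e (edge l) (edge r) np el er veq top)

shifts-balance : ∀ s e v l r → HTreeCond (node e v l r) →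
  offset (leftShift e v r s) (edge l) ℤ.+ offset (rightShift e v l s) (edge r) ≡ + v ℤ.+ offset s e
shifts-balance s e v l r ((veq , _) , (_ , top , _))
  with nonpos e in ee | nonpos (edge l) in el | nonpos (edge r) in er
... | true  | true  | true  = ℤP.+-comm s (+ v)
... | true  | true  | false rewrite top = ℤP.+-comm s 0ℤ
... | true  | false | true  rewrite top = refl
... | true  | false | false = ⊥-elim (nonpos-pos-pos⇒vertex≢0 e (edge l) (edge r) ee el er veq top)
... | false | true  | true  = ℤP.+-comm 0ℤ (+ v)
... | false | true  | false = refl
... | false | false | true  = ℤP.+-comm 0ℤ (+ v)
... | false | false | false rewrite top = refl

labelRule-toQ : ∀ s t → HTreeCond t → LabelRule (toQ s t)
labelRule-toQ s (leaf _)       _ = tt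
labelRule-toQ s (node e v l r) h@((veq , rl , rr) , (_ , _ , hl , hr)) =
  vertex , labelRule-toQ sl l (rl , hl) , labelRule-toQ sr r (rr , hr)
  where
  sl = leftShift e v r s
  sr = rightShift e v l s
  vertex : 0ℤ ≡ vertexLabel (e - offset s e) (edge (toQ sl l)) (edge (toQ sr r))
  vertex rewrite edge-toQ sl l | edge-toQ sr r = sym (begin
    vertexLabel (e - offset s e) (edge l - offset sl (edge l)) (edge r - offset sr (edge r))
      ≡⟨ vertexLabel-lower e (edge l) (edge r) (offset s e) (offset sl (edge l)) (offset sr (edge r)) ⟩
    vertexLabel e (edge l) (edge r) ℤ.+ offset s e - (offset sl (edge l) ℤ.+ offset sr (edge r))
      ≡⟨ cong₂ (λ x y → x ℤ.+ offset s e - y) (sym veq) (shifts-balance s e v l r h) ⟩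
    + v ℤ.+ offset s e - (+ v ℤ.+ offset s e)
      ≡⟨ ℤP.+-inverseʳ (+ v ℤ.+ offset s e) ⟩
    0ℤ ∎)
    where open ≡-Reasoning

preQ-toQ : ∀ s t → HCond t → 0ℤ ≤ s → PreQCond (toQ s t)
preQ-toQ s (leaf .0ℤ)     refl              0≤s = ℤP.i≤j⇒i-j≤0 0≤s
preQ-toQ s (node e v l r) (_ , _ , hl , hr) 0≤s =
  refl , preQ-toQ _ l hl (leftShift-nonneg e v r 0≤s) , preQ-toQ _ r hr (rightShift-nonneg e v l 0≤s)

Strong-∷-lowered : ∀ e s c → nonpos e ≡ true → ℤ.NonZero e → descentEnd c ≡ - s →
                   Strong (pathFrom c) → Strong (e - s ∷ pathFrom c)
Strong-∷-lowered e s c np nz end≡-s = Strong-∷⁺ (e - s) c (subst (e - s <_) (sym end≡-s) e-s<-s)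
  where
  e-s<-s : e - s < - s
  e-s<-s = subst (e - s <_) (ℤP.+-identityˡ (- s)) (ℤP.+-monoˡ-< (- s) (nonpos∧nonZero⇒<0 {e} np nz))

strongPath-toQ : ∀ s t → HTreeCond t → 0ℤ ≤ s → nonpos (edge t) ≡ true → Strong (pathFrom (toQ s t))
strongPath-toQ s (leaf _) _ _ _ = tt
strongPath-toQ s (node e v l r) ((veq , rl , rr) , (nz , top , hl , hr)) 0≤s np
  rewrite np with nonpos (edge l) in el | nonpos (edge r) in er
... | true  | _ rewrite trans (nonpos-toQ s l 0≤s) el =
  Strong-∷-lowered e s (toQ s l) np nz (descentEnd-toQ s l (rl , hl) 0≤s el)
    (strongPath-toQ s l (rl , hl) 0≤s el)
... | false | true rewrite trans (nonpos-toQ s l 0≤s) el | trans (nonpos-toQ s r 0≤s) er =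
  Strong-∷-lowered e s (toQ s r) np nz (descentEnd-toQ s r (rr , hr) 0≤s er)
    (strongPath-toQ s r (rr , hr) 0≤s er)
... | false | false = ⊥-elim (nonpos-pos-pos⇒vertex≢0 e (edge l) (edge r) np el er veq top)

everywhere-toQ : ∀ s t → HTreeCond t → 0ℤ ≤ s → Everywhere StartsStrongPath (toQ s t)
everywhere-toQ s (leaf _)       _ _ _ = tt
everywhere-toQ s (node e v l r) h@((_ , rl , rr) , (_ , _ , hl , hr)) 0≤s =
  (λ np → strongPath-toQ s (node e v l r) h 0≤s (trans (sym (nonpos-toQ s (node e v l r) 0≤s)) np)) ,
  everywhere-toQ _ l (rl , hl) (leftShift-nonneg e v r 0≤s) ,
  everywhere-toQ _ r (rr , hr) (rightShift-nonneg e v l 0≤s)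

QTreeCond-toQ : ∀ s t → HTreeCond t → 0ℤ ≤ s → QTreeCond (toQ s t)
QTreeCond-toQ s t h@(_ , hc) 0≤s = labelRule-toQ s t h , preQ-toQ s t hc 0≤s , everywhere-toQ s t h 0≤s

-- From Q-trees to H-trees

descentOffset : LTree → ℤ
descentOffset t = offset (descentEnd t) (edge t)

balance : LTree → ℤ
balance (leaf _)         = 0ℤ
balance t@(node _ _ l r) = descentOffset t - (descentOffset l ℤ.+ descentOffset r)

-- ∣_∣ loses nothing on Q-trees, where the balance is non-negative (balance-nonneg).
toH : LTree → LTree
toH (leaf e)         = leaf (e - descentOffset (leaf e))
toH t@(node e _ l r) = node (e - descentOffset t) ∣ balance t ∣ (toH l) (toH r)

edge-toH : ∀ t → edge (toH t) ≡ edge t - descentOffset t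
edge-toH (leaf _)       = refl
edge-toH (node _ _ _ _) = refl

leaves-toH : ∀ t → leaves (toH t) ≡ leaves t
leaves-toH (leaf _)       = refl
leaves-toH (node e v l r) = cong₂ ℕ._+_ (leaves-toH l) (leaves-toH r)

descentEnd≤0 : ∀ t → PreQCond t → nonpos (edge t) ≡ true → descentEnd t ≤ 0ℤ
descentEnd≤0 (leaf e)       e≤0       _  = e≤0
descentEnd≤0 (node e v l r) (_ , pl , pr) np with nonpos (edge l) in el | nonpos (edge r) in er
... | true  | _     = descentEnd≤0 l pl el
... | false | true  = descentEnd≤0 r pr er
... | false | false = nonpos⇒≤0 np

edge<descentEnd : ∀ e v l r → QTreeCond (node e v l r) → nonpos e ≡ true → e < descentEnd (node e v l r)
edge<descentEnd e v l r ((veq , _) , (refl , _) , (root , _)) np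
  with nonpos (edge l) in el | nonpos (edge r) in er | root np
... | true  | _     | s = proj₁ (Strong-∷⁻ e l s)
... | false | true  | s = proj₁ (Strong-∷⁻ e r s)
... | false | false | _ = ⊥-elim (nonpos-pos-pos⇒vertex≢0 e (edge l) (edge r) np el er veq refl)

edge≤descentEnd : ∀ t → QTreeCond t → nonpos (edge t) ≡ true → edge t ≤ descentEnd t
edge≤descentEnd (leaf e)       _ _  = ℤP.≤-refl
edge≤descentEnd (node e v l r) q np = ℤP.<⇒≤ (edge<descentEnd e v l r q np)

nonpos-toH : ∀ t → QTreeCond t → nonpos (edge (toH t)) ≡ nonpos (edge t)
nonpos-toH t q = trans (cong nonpos (edge-toH t)) (nonpos-lower (edge t) (descentEnd t) (edge≤descentEnd t q))

vertexLabel-toH : ∀ e v l r → QTreeCond (node e v l r) →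
  vertexLabel (e - descentOffset (node e v l r)) (edge (toH l)) (edge (toH r)) ≡ balance (node e v l r)
vertexLabel-toH e v l r ((veq , _) , (refl , _) , _) = begin
  vertexLabel (e - c) (edge (toH l)) (edge (toH r))
    ≡⟨ cong₂ (vertexLabel (e - c)) (edge-toH l) (edge-toH r) ⟩
  vertexLabel (e - c) (edge l - a) (edge r - b)
    ≡⟨ vertexLabel-lower e (edge l) (edge r) c a b ⟩
  vertexLabel e (edge l) (edge r) ℤ.+ c - (a ℤ.+ b)
    ≡⟨ cong (λ x → x ℤ.+ c - (a ℤ.+ b)) (sym veq) ⟩
  0ℤ ℤ.+ c - (a ℤ.+ b)
    ≡⟨ cong (_- (a ℤ.+ b)) (ℤP.+-identityˡ c) ⟩
  c - (a ℤ.+ b) ∎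
  where
  open ≡-Reasoning
  c = descentOffset (node e 0 l r)
  a = descentOffset l
  b = descentOffset r

balance-nonneg : ∀ e v l r → QTreeCond (node e v l r) → 0ℤ ≤ balance (node e v l r)
balance-nonneg e v l r ((veq , _) , (refl , pl , pr) , _)
  with nonpos e in ee | nonpos (edge l) in el | nonpos (edge r) in er
... | true  | true  | true  =
  subst (0ℤ ≤_) (sym (i-[i+j]≡-j (descentEnd l) (descentEnd r))) (ℤP.neg-mono-≤ (descentEnd≤0 r pr er))
... | true  | true  | false = ℤP.i≤j⇒0≤j-i (ℤP.≤-reflexive (ℤP.+-identityʳ (descentEnd l)))
... | true  | false | true  = ℤP.i≤j⇒0≤j-i (ℤP.≤-reflexive (ℤP.+-identityˡ (descentEnd r)))
... | true  | false | false = ⊥-elim (nonpos-pos-pos⇒vertex≢0 e (edge l) (edge r) ee el er veq refl)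
... | false | true  | true  = ℤP.i≤j⇒0≤j-i (ℤP.+-mono-≤ (descentEnd≤0 l pl el) (descentEnd≤0 r pr er))
... | false | true  | false = ℤP.i≤j⇒0≤j-i (ℤP.+-mono-≤ (descentEnd≤0 l pl el) (ℤP.≤-refl {0ℤ}))
... | false | false | true  = ℤP.i≤j⇒0≤j-i (ℤP.+-mono-≤ (ℤP.≤-refl {0ℤ}) (descentEnd≤0 r pr er))
... | false | false | false = ℤP.≤-refl

balance-top : ∀ e v l r → QTreeCond (node e v l r) → isBottom e l r ≡ false → balance (node e v l r) ≡ 0ℤ
balance-top e v l r ((veq , _) , (refl , _) , _)
  with nonpos e in ee | nonpos (edge l) in el | nonpos (edge r) in er
... | true  | true  | true  = λ ()
... | true  | true  | false = λ _ → ℤP.i≡j⇒i-j≡0 (sym (ℤP.+-identityʳ (descentEnd l)))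
... | true  | false | true  = λ _ → ℤP.i≡j⇒i-j≡0 (sym (ℤP.+-identityˡ (descentEnd r)))
... | true  | false | false = ⊥-elim (nonpos-pos-pos⇒vertex≢0 e (edge l) (edge r) ee el er veq refl)
... | false | true  | true  = λ ()
... | false | true  | false = λ ()
... | false | false | true  = λ ()
... | false | false | false = λ _ → refl

labelRule-toH : ∀ t → QTreeCond t → LabelRule (toH t)
labelRule-toH (leaf _)       _ = tt
labelRule-toH (node e v l r) q =
  trans (ℤP.0≤i⇒+∣i∣≡i (balance-nonneg e v l r q)) (sym (vertexLabel-toH e v l r q)) ,
  labelRule-toH l (proj₁ (QTreeCond-children q)) , labelRule-toH r (proj₂ (QTreeCond-children q))

hCond-toH : ∀ t → QTreeCond t → HCond (toH t)
hCond-toH (leaf e) (_ , e≤0 , _) rewrite ≤0⇒nonpos e≤0 = ℤP.+-inverseʳ e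
hCond-toH (node e v l r) q =
  nonZero-lower e (descentEnd (node e v l r)) (edge<descentEnd e v l r q) ,
  topCondition (isBottom (e - descentOffset (node e v l r)) (toH l) (toH r))
    (λ top → cong ∣_∣ (balance-top e v l r q (trans bottom-toH top))) ,
  hCond-toH l ql , hCond-toH r qr
  where
  ql = proj₁ (QTreeCond-children q)
  qr = proj₂ (QTreeCond-children q)
  bottom-toH : isBottom e l r ≡ isBottom (e - descentOffset (node e v l r)) (toH l) (toH r)
  bottom-toH = isBottom-cong e l r (e - descentOffset (node e v l r)) (toH l) (toH r)
    (sym (nonpos-toH (node e v l r) q)) (sym (nonpos-toH l ql)) (sym (nonpos-toH r qr))

-- The two maps are mutually inverse

edge-toH∘toQ : ∀ s t → HTreeCond t → 0ℤ ≤ s → edge (toH (toQ s t)) ≡ edge t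
edge-toH∘toQ s t h 0≤s = begin
  edge (toH (toQ s t))                                  ≡⟨ edge-toH (toQ s t) ⟩
  edge (toQ s t) - descentOffset (toQ s t)              ≡⟨ cong₂ _-_ (edge-toQ s t) descentOffset-toQ ⟩
  edge t - offset s (edge t) - (- offset s (edge t))    ≡⟨ i-j-[-j]≡i (edge t) (offset s (edge t)) ⟩
  edge t                                                ∎
  where
  open ≡-Reasoning
  descentOffset-toQ : descentOffset (toQ s t) ≡ - offset s (edge t)
  descentOffset-toQ = trans (offset-cong (descentEnd (toQ s t)) (edge (toQ s t)) (edge t) (nonpos-toQ s t 0≤s))
    (offset-inverse (edge t) s (descentEnd (toQ s t)) (descentEnd-toQ s t h 0≤s))

toH∘toQ : ∀ s t → HTreeCond t → 0ℤ ≤ s → toH (toQ s t) ≡ t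
toH∘toQ s (leaf .0ℤ) h@(_ , refl) 0≤s = cong leaf (edge-toH∘toQ s (leaf 0ℤ) h 0≤s)
toH∘toQ s t@(node e v l r) h@((veq , _) , _) 0≤s =
  node-cong (edge-toH∘toQ s t h 0≤s) vertex toH∘toQ-l toH∘toQ-r
  where
  sl = leftShift e v r s
  sr = rightShift e v l s
  toH∘toQ-l = toH∘toQ sl l (proj₁ (HTreeCond-children h)) (leftShift-nonneg e v r 0≤s)
  toH∘toQ-r = toH∘toQ sr r (proj₂ (HTreeCond-children h)) (rightShift-nonneg e v l 0≤s)
  vertex : ∣ balance (toQ s t) ∣ ≡ v
  vertex = cong ∣_∣ (begin
    balance (toQ s t)
      ≡⟨ sym (vertexLabel-toH (e - offset s e) 0 (toQ sl l) (toQ sr r) (QTreeCond-toQ s t h 0≤s)) ⟩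
    vertexLabel (edge (toH (toQ s t))) (edge (toH (toQ sl l))) (edge (toH (toQ sr r)))
      ≡⟨ vertexLabel-cong (edge-toH∘toQ s t h 0≤s) (cong edge toH∘toQ-l) (cong edge toH∘toQ-r) ⟩
    vertexLabel e (edge l) (edge r)
      ≡⟨ sym veq ⟩
    + v ∎)
    where open ≡-Reasoning

edge-toQ∘toH : ∀ s t → QTreeCond t → (nonpos (edge t) ≡ true → s ≡ - descentEnd t) →
               edge (toQ s (toH t)) ≡ edge t
edge-toQ∘toH s t q s≡-end = begin
  edge (toQ s (toH t))                            ≡⟨ edge-toQ s (toH t) ⟩
  edge (toH t) - offset s (edge (toH t))          ≡⟨ cong₂ _-_ (edge-toH t) offset-toH ⟩
  edge t - descentOffset t - (- descentOffset t)  ≡⟨ i-j-[-j]≡i (edge t) (descentOffset t) ⟩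
  edge t                                          ∎
  where
  open ≡-Reasoning
  offset-toH : offset s (edge (toH t)) ≡ - descentOffset t
  offset-toH = trans (offset-cong s (edge (toH t)) (edge t) (nonpos-toH t q))
    (offset-inverse (edge t) (descentEnd t) s s≡-end)

special-descentEnd≡0 : ∀ e l r → 0ℤ ≡ vertexLabel e (edge l) (edge r) → nonpos e ≡ false →
                       nonpos (edge r) ≡ true → QTreeCond l → nonpos (edge l) ≡ true → descentEnd l ≡ 0ℤ
special-descentEnd≡0 e l r veq ee er ql@(_ , pl , _) el =
  ℤP.≤-antisym (descentEnd≤0 l pl el) (ℤP.≤-trans 0≤edge-l (edge≤descentEnd l ql el))
  where
  regroup : ∀ l r e → (l ℤ.+ r - e ℤ.+ 1ℤ) ℤ.+ ((e - 1ℤ) ℤ.+ - r) ≡ l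
  regroup = solve-∀
  0≤edge-l : 0ℤ ≤ edge l
  0≤edge-l = begin
    0ℤ                                   ≤⟨ ℤP.+-mono-≤ 0≤e-1 (ℤP.neg-mono-≤ (nonpos⇒≤0 er)) ⟩
    (e - 1ℤ) ℤ.+ - edge r                ≡⟨ ℤP.+-identityˡ _ ⟨
    0ℤ ℤ.+ ((e - 1ℤ) ℤ.+ - edge r)       ≡⟨ cong (ℤ._+ ((e - 1ℤ) ℤ.+ - edge r)) veq ⟩
    vertexLabel e (edge l) (edge r) ℤ.+ ((e - 1ℤ) ℤ.+ - edge r)
                                         ≡⟨ regroup (edge l) (edge r) e ⟩
    edge l                               ∎
    where
    open ℤP.≤-Reasoning
    0≤e-1 : 0ℤ ≤ e - 1ℤ
    0≤e-1 = ℤP.i≤j⇒0≤j-i (ℤP.i<j⇒suc[i]≤j (¬nonpos⇒>0 {e} ee))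

leftShift-toH : ∀ s e v l r → QTreeCond (node e v l r) → (nonpos e ≡ true → s ≡ - descentEnd (node e v l r)) →
  nonpos (edge l) ≡ true →
  leftShift (e - descentOffset (node e v l r)) ∣ balance (node e v l r) ∣ (toH r) s ≡ - descentEnd l
leftShift-toH s e .0 l r q@((veq , _) , (refl , _) , _) s≡-end np
  rewrite nonpos-toH (node e 0 l r) q | nonpos-toH r (proj₂ (QTreeCond-children q))
  with nonpos e in ee | nonpos (edge l) in el | nonpos (edge r) in er
     | ℤP.0≤i⇒+∣i∣≡i (balance-nonneg e 0 l r q)
... | true  | true  | _     | _   = s≡-end refl
... | false | true  | true  | _   =
  cong -_ (sym (special-descentEnd≡0 e l r veq ee er (proj₁ (QTreeCond-children q)) el))
... | false | true  | false | bal = trans bal (0-[i+0]≡-i (descentEnd l))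
... | _     | false | _     | _   = true≢false np refl

rightShift-toH : ∀ s e v l r → QTreeCond (node e v l r) → (nonpos e ≡ true → s ≡ - descentEnd (node e v l r)) →
  nonpos (edge r) ≡ true →
  rightShift (e - descentOffset (node e v l r)) ∣ balance (node e v l r) ∣ (toH l) s ≡ - descentEnd r
rightShift-toH s e .0 l r q@((veq , _) , (refl , _) , _) s≡-end np
  rewrite nonpos-toH (node e 0 l r) q | nonpos-toH l (proj₁ (QTreeCond-children q))
  with nonpos e in ee | nonpos (edge l) in el | nonpos (edge r) in er
     | ℤP.0≤i⇒+∣i∣≡i (balance-nonneg e 0 l r q)
... | true  | true  | true  | bal = trans bal (i-[i+j]≡-j (descentEnd l) (descentEnd r))
... | true  | false | true  | _   = s≡-end refl
... | false | true  | true  | bal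
  rewrite special-descentEnd≡0 e l r veq ee er (proj₁ (QTreeCond-children q)) el =
  trans bal (0-[0+j]≡-j (descentEnd r))
... | false | false | true  | bal = trans bal (0-[0+j]≡-j (descentEnd r))
... | _     | _     | false | _   = true≢false np refl

toQ∘toH : ∀ s t → QTreeCond t → (nonpos (edge t) ≡ true → s ≡ - descentEnd t) → toQ s (toH t) ≡ t
toQ∘toH s (leaf e)        q s≡-end = cong leaf (edge-toQ∘toH s (leaf e) q s≡-end)
toQ∘toH s (node e .0 l r) q@(_ , (refl , _) , _) s≡-end =
  node-cong (edge-toQ∘toH s (node e 0 l r) q s≡-end) refl
    (toQ∘toH _ l (proj₁ (QTreeCond-children q)) (leftShift-toH s e 0 l r q s≡-end))
    (toQ∘toH _ r (proj₂ (QTreeCond-children q)) (rightShift-toH s e 0 l r q s≡-end))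

LabelRule-irrelevant : ∀ t → Irrelevant (LabelRule t)
LabelRule-irrelevant (leaf _)       tt           tt           = refl
LabelRule-irrelevant (node e v l r) (a , al , ar) (b , bl , br) =
  cong₂ _,_ (uip a b) (cong₂ _,_ (LabelRule-irrelevant l al bl) (LabelRule-irrelevant r ar br))

nonZero-irrelevant : ∀ i → Irrelevant (ℤ.NonZero i)
nonZero-irrelevant (+ zero)   ()
nonZero-irrelevant +[1+ n ]   _ _ = refl
nonZero-irrelevant -[1+ n ]   _ _ = refl

topCondition-irrelevant : ∀ b n → Irrelevant (if b then ⊤ else n ≡ 0)
topCondition-irrelevant true  n tt tt = refl
topCondition-irrelevant false n a  b  = uip a b

HCond-irrelevant : ∀ t → Irrelevant (HCond t)
HCond-irrelevant (leaf _)       a b = uip a b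
HCond-irrelevant (node e v l r) (a₁ , a₂ , al , ar) (b₁ , b₂ , bl , br) =
  cong₂ _,_ (nonZero-irrelevant e a₁ b₁)
    (cong₂ _,_ (topCondition-irrelevant (isBottom e l r) v a₂ b₂)
      (cong₂ _,_ (HCond-irrelevant l al bl) (HCond-irrelevant r ar br)))

PreQCond-irrelevant : ∀ t → Irrelevant (PreQCond t)
PreQCond-irrelevant (leaf _)       a b = ℤP.≤-irrelevant a b
PreQCond-irrelevant (node e v l r) (a , al , ar) (b , bl , br) =
  cong₂ _,_ (uip a b) (cong₂ _,_ (PreQCond-irrelevant l al bl) (PreQCond-irrelevant r ar br))

Strong-irrelevant : ∀ xs → Irrelevant (Strong xs)
Strong-irrelevant (x ∷ [])     tt       tt       = refl
Strong-irrelevant (x ∷ y ∷ xs) (a , as) (b , bs) =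
  cong₂ _,_ (ℤP.<-irrelevant a b) (Strong-irrelevant (y ∷ xs) as bs)

IsPartitionTree-irrelevant : ∀ n p t → Irrelevant (IsPartitionTree n p t)
IsPartitionTree-irrelevant n p t (a₁ , a₂ , a₃) (b₁ , b₂ , b₃) =
  cong₂ _,_ (uip a₁ b₁) (cong₂ _,_ (uip a₂ b₂) (LabelRule-irrelevant t a₃ b₃))

HUnion-≡ : ∀ {n p p₁ p₂ t₁ t₂ a₁ b₁ h₁ a₂ b₂ h₂} → p₁ ≡ p₂ → t₁ ≡ t₂ →
           _≡_ {A = HUnion n p} (p₁ , a₁ , b₁ , t₁ , h₁) (p₂ , a₂ , b₂ , t₂ , h₂)
HUnion-≡ {n} {t₁ = t} {a₁ = a₁} {b₁} {h₁ , k₁} {a₂} {b₂} {h₂ , k₂} refl refl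
  rewrite ℤP.≤-irrelevant a₁ a₂ | ℤP.≤-irrelevant b₁ b₂
        | IsPartitionTree-irrelevant n _ t h₁ h₂ | HCond-irrelevant t k₁ k₂ = refl

QTrees-≡ : ∀ {n p t₁ t₂ q₁ q₂} → t₁ ≡ t₂ → _≡_ {A = QTrees n p} (t₁ , q₁) (t₂ , q₂)
QTrees-≡ {n} {p} {t} {q₁ = a₁ , a₂ , a₃} {b₁ , b₂ , b₃} refl
  rewrite IsPartitionTree-irrelevant n p t a₁ b₁ | PreQCond-irrelevant t a₂ b₂
        | All.irrelevant (Strong-irrelevant _) a₃ b₃ = refl

module _ (n : ℕ) (p : ℤ) (p<0 : p < 0ℤ) where

  ψ : HUnion n p → QTrees n p
  ψ (p′ , p≤p′ , p′≤0 , t , (leaves≡n , edge≡p′ , lr) , hc)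
    with QTreeCond-toQ (p′ - p) t (lr , hc) (ℤP.i≤j⇒0≤j-i p≤p′)
  ... | lr′ , pq , ev =
    toQ (p′ - p) t , (trans (leaves-toQ _ t) leaves≡n , edge≡p , lr′) , pq ,
    everywhere⇒allPaths (toQ (p′ - p) t) ev
    where
    edge≡p : edge (toQ (p′ - p) t) ≡ p
    edge≡p rewrite edge-toQ (p′ - p) t | edge≡p′ | ≤0⇒nonpos p′≤0 = i-[i-j]≡j p′ p

  ψ⁻¹ : QTrees n p → HUnion n p
  ψ⁻¹ (t , (leaves≡n , edge≡p , lr) , pq , paths) =
    p - descentEnd t , p≤p′ , p′≤0 , toH t ,
    (trans (leaves-toH t) leaves≡n , edge≡p′ , labelRule-toH t q) , hCond-toH t q
    where
    q : QTreeCond t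
    q = lr , pq , allPaths⇒everywhere t paths
    np : nonpos (edge t) ≡ true
    np = ≤0⇒nonpos (subst (_≤ 0ℤ) (sym edge≡p) (ℤP.<⇒≤ p<0))
    p≤p′ : p ≤ p - descentEnd t
    p≤p′ = ℤP.≤-trans (ℤP.≤-reflexive (sym (ℤP.+-identityʳ p)))
             (ℤP.+-monoʳ-≤ p (ℤP.neg-mono-≤ (descentEnd≤0 t pq np)))
    p′≤0 : p - descentEnd t ≤ 0ℤ
    p′≤0 = ℤP.i≤j⇒i-j≤0 (subst (_≤ descentEnd t) edge≡p (edge≤descentEnd t q np))
    edge≡p′ : edge (toH t) ≡ p - descentEnd t
    edge≡p′ rewrite edge-toH t | np | edge≡p = refl

  ψ∘ψ⁻¹ : ∀ y → ψ (ψ⁻¹ y) ≡ y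
  ψ∘ψ⁻¹ (t , (_ , edge≡p , lr) , pq , paths) = QTrees-≡
    (toQ∘toH _ t (lr , pq , allPaths⇒everywhere t paths) (λ _ → i-j-i≡-j p (descentEnd t)))

  ψ⁻¹∘ψ : ∀ x → ψ⁻¹ (ψ x) ≡ x
  ψ⁻¹∘ψ (p′ , p≤p′ , p′≤0 , t , (_ , edge≡p′ , lr) , hc) =
    HUnion-≡ base (toH∘toQ (p′ - p) t (lr , hc) 0≤s)
    where
    0≤s = ℤP.i≤j⇒0≤j-i p≤p′
    np : nonpos (edge t) ≡ true
    np = ≤0⇒nonpos (subst (_≤ 0ℤ) (sym edge≡p′) p′≤0)
    base : p - descentEnd (toQ (p′ - p) t) ≡ p′
    base rewrite descentEnd-toQ (p′ - p) t (lr , hc) 0≤s np = i-[-[j-i]]≡j p p′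

proposition4p6 : (p : ℤ) (n : ℕ) → p < 0ℤ → 1 Data.Nat.≤ n → HUnion n p ⤖ QTrees n p
proposition4p6 p n p<0 _ = ↔⇒⤖ (mk↔ₛ′ (ψ n p p<0) (ψ⁻¹ n p p<0) (ψ∘ψ⁻¹ n p p<0) (ψ⁻¹∘ψ n p p<0))
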